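{- Let $n,m\in\mathbb{N}$ and let $X\subseteq\mathbb{N}$ be a finite $(\omega^{n+m}+\omega^n)$-large set. Then there exist $d\in\mathbb{N}$ and $\omega^n$-large subsets $X_0<\dots<X_d$ of $X$ such that $\{\max X_i:i<d\}$ is $\omega^m$-large.
   Context: $X<Y$ means every element of $X$ is below every element of $Y$. Fundamental sequences: $\{0\}(x)=0$; for $\alpha\neq0$ write $\alpha=\delta+\omega^\gamma$ in Cantor normal form with $\omega^\gamma$ the last term; $\{\alpha\}(x)=\delta$ if $\gamma=0$, $\delta+\omega^{\gamma'}\cdot x$ if $\gamma=\gamma'+1$, $\delta+\omega^{\{\gamma\}(x)}$ if $\gamma$ is a limit. For finite $X=\{x_0<\dots<x_s\}$, $\{\alpha\}(X)=\{\cdots\{\{\alpha\}(x_0)\}(x_1)\cdots\}(x_s)$ and $X$ is $\alpha$-large iff $\{\alpha\}(X)=0$. -}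

module Defs where

open import Data.Nat using (ℕ; zero; suc; _+_; _<_; _⊔_)
open import Data.List using (List; []; _∷_; foldr)
open import Data.List.Relation.Unary.All using (All)
open import Relation.Binary.PropositionalEquality using (_≡_)

-- Ordinals below ε₀ as Cantor-normal-form terms, written from the last term:
-- δ +ω^ γ  denotes  δ + ω^γ  (ω^γ is the last CNF term).
infixl 6 _+ω^_
data Ord : Set where
  𝟎     : Ord
  _+ω^_ : Ord → Ord → Ord

ω^_ : Ord → Ord
ω^ γ = 𝟎 +ω^ γ

fromℕ : ℕ → Ord
fromℕ zero    = 𝟎
fromℕ (suc k) = fromℕ k +ω^ 𝟎

_+ω^_·_ : Ord → Ord → ℕ → Ord
δ +ω^ γ · zero  = δ
δ +ω^ γ · suc x = (δ +ω^ γ · x) +ω^ γ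

fs : Ord → ℕ → Ord
fs 𝟎 x = 𝟎
fs (δ +ω^ 𝟎) x = δ
fs (δ +ω^ (γ' +ω^ 𝟎)) x = δ +ω^ γ' · x              -- γ = γ' + 1
fs (δ +ω^ (γ₁ +ω^ (γ₂ +ω^ γ₃))) x = δ +ω^ fs (γ₁ +ω^ (γ₂ +ω^ γ₃)) x  -- γ limit

fsSet : Ord → List ℕ → Ord
fsSet α []       = α
fsSet α (x ∷ xs) = fsSet (fs α x) xs

-- X is α-large (X given as a strictly increasing list)
Large : Ord → List ℕ → Set
Large α X = fsSet α X ≡ 𝟎

_<ₛ_ : List ℕ → List ℕ → Set
X <ₛ Y = All (λ x → All (x <_) Y) X

-- max of a finite set (0 for the empty set; only used on nonempty sets)
maxₛ : List ℕ → ℕ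
maxₛ = foldr _⊔_ 0

{-# OPTIONS --safe #-}
-- For β < ω^ω, coded by its list of exponents, an (ω^n·β + ω^n)-large set splits into an
-- ω^n-large first block B and an ω^n·β-large rest, all of whose elements exceed M = max B.
-- If β = β' + ω^(k+1), the first element x of the rest turns ω^n·β into
-- ω^n·β' + ω^(n+k)·x = (ω^n·β[M] + ω^(n+k)) + ω^(n+k)·(x ∸ M ∸ 1), where β[M] = {β}(M),
-- so some end segment is (ω^n·β[M] + ω^(n+k))-large; lowering the exponent n+k to n in the
-- same way (with M = 0, which is why positivity is needed) leaves an (ω^n·β[M] + ω^n)-large
-- end segment. Recursing on it gives blocks whose maxima form a β[M]-large set, and putting
-- M in front makes it β-large. The theorem is the case β = ω^m.
module Submission where

open import Defs
open import Data.Nat using (ℕ; zero; suc; _+_; _∸_; _<_; s≤s)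
open import Data.Nat.Properties using (+-identityʳ; +-suc; ⊔-lub; ≤-trans; <-trans; m∸n+n≡m; m<n⇒0<n)
open import Data.Nat.Induction using (<-wellFounded)
open import Induction.WellFounded using (Acc; acc)
open import Data.Fin as Fin using (Fin; inject₁)
open import Data.Product using (Σ; _×_; _,_)
open import Data.List using (List; []; _∷_; _++_; length; replicate; tabulate)
open import Data.List.Properties using (++-assoc; length-++-≤ʳ; foldr-preservesᵇ)
open import Data.List.Relation.Unary.All as All using (All; []; _∷_)
open import Data.List.Relation.Unary.All.Properties using (++⁻ˡ; ++⁻ʳ; All-swap; anti-mono)
open import Data.List.Relation.Unary.AllPairs using (AllPairs; []; _∷_)
open import Data.List.Relation.Unary.Linked using (Linked)
open import Data.List.Relation.Unary.Linked.Properties using (AllPairs⇒Linked; Linked⇒AllPairs)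
open import Data.List.Membership.Propositional using (_∈_)
open import Data.List.Membership.Propositional.Properties using (∈-++⁺ˡ; ∈-++⁺ʳ)
open import Data.List.Relation.Binary.Subset.Propositional using (_⊆_)
open import Relation.Binary.PropositionalEquality using (_≡_; refl; sym; trans; cong; subst)

infixl 5 _⊕_
_⊕_ : Ord → Ord → Ord
β ⊕ 𝟎        = β
β ⊕ (δ +ω^ e) = (β ⊕ δ) +ω^ e

⊕-+ω^· : ∀ β δ e x → β ⊕ (δ +ω^ e · x) ≡ (β ⊕ δ) +ω^ e · x
⊕-+ω^· β δ e zero    = refl
⊕-+ω^· β δ e (suc x) = cong (_+ω^ e) (⊕-+ω^· β δ e x)

+ω^·-+ : ∀ δ e p q → δ +ω^ e · (p + q) ≡ (δ +ω^ e · q) ⊕ (𝟎 +ω^ e · p)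
+ω^·-+ δ e zero    q = refl
+ω^·-+ δ e (suc p) q = cong (_+ω^ e) (+ω^·-+ δ e p q)

fs-⊕ : ∀ β δ e x → fs (β ⊕ (δ +ω^ e)) x ≡ β ⊕ fs (δ +ω^ e) x
fs-⊕ β δ 𝟎                   x = refl
fs-⊕ β δ (e +ω^ 𝟎)           x = sym (⊕-+ω^· β δ e x)
fs-⊕ β δ (e +ω^ (e₁ +ω^ e₂)) x = refl

large-⊕⇒++ : ∀ β γ Z → Large (β ⊕ γ) Z →
  Σ (List ℕ) λ Z₁ → Σ (List ℕ) λ Z₂ → Z ≡ Z₁ ++ Z₂ × Large γ Z₁ × Large β Z₂
large-⊕⇒++ β 𝟎         Z       large = [] , Z , refl , refl , large
large-⊕⇒++ β (δ +ω^ e) []      ()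
large-⊕⇒++ β (δ +ω^ e) (x ∷ Z) large
  with Z₁ , Z₂ , refl , large₁ , large₂ ←
         large-⊕⇒++ β (fs (δ +ω^ e) x) Z (subst (λ α → Large α Z) (fs-⊕ β δ e x) large)
  = x ∷ Z₁ , Z₂ , refl , large₁ , large₂

HasLargeSuffix : Ord → List ℕ → Set
HasLargeSuffix α Z = Σ (List ℕ) λ P → Σ (List ℕ) λ W → Z ≡ P ++ W × Large α W

++-hasLargeSuffix : ∀ P {α W} → HasLargeSuffix α W → HasLargeSuffix α (P ++ W)
++-hasLargeSuffix P (Q , V , refl , large) = P ++ Q , V , sym (++-assoc P Q V) , large

+ω^·-split : ∀ γ e {M x} → M < x →
  γ +ω^ e · x ≡ ((γ +ω^ e · M) +ω^ e) ⊕ (𝟎 +ω^ e · (x ∸ suc M))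
+ω^·-split γ e {M} {x} M<x =
  trans (cong (γ +ω^ e ·_) (sym (m∸n+n≡m M<x))) (+ω^·-+ γ e (x ∸ suc M) (suc M))

large-+ω^-suc⇒suffix : ∀ {γ e x M Z} → M < x → Large (γ +ω^ (e +ω^ 𝟎)) (x ∷ Z) →
  HasLargeSuffix ((γ +ω^ e · M) +ω^ e) Z
large-+ω^-suc⇒suffix {γ} {e} {x} {M} {Z} M<x large
  with P , W , Z≡P++W , _ , largeW ←
         large-⊕⇒++ ((γ +ω^ e · M) +ω^ e) (𝟎 +ω^ e · (x ∸ suc M)) Z
           (subst (λ α → Large α Z) (+ω^·-split γ e M<x) large)
  = P , W , Z≡P++W , largeW

large-+ω^-lower⇒suffix : ∀ n j {γ Z} → All (0 <_) Z → Large (γ +ω^ fromℕ (n + j)) Z →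
  HasLargeSuffix (γ +ω^ fromℕ n) Z
large-+ω^-lower⇒suffix n zero    _ large rewrite +-identityʳ n = [] , _ , refl , large
large-+ω^-lower⇒suffix n (suc j) {Z = []} _ ()
large-+ω^-lower⇒suffix n (suc j) {Z = x ∷ Z} (0<x ∷ positive) large rewrite +-suc n j
  with P , W , refl , largeW ← large-+ω^-suc⇒suffix {Z = Z} 0<x large
  = ++-hasLargeSuffix (x ∷ P) (large-+ω^-lower⇒suffix n j (++⁻ʳ P positive) largeW)

-- ω^ n ·Σω^ (k₀ ∷ ⋯ ∷ kᵣ) is ω^n · (ω^kᵣ + ⋯ + ω^k₀), so ω^ 0 ·Σω^ ks is the ordinal
-- below ω^ω coded by ks.
infix 8 ω^_·Σω^_
ω^_·Σω^_ : ℕ → List ℕ → Ord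
ω^ n ·Σω^ []       = 𝟎
ω^ n ·Σω^ (k ∷ ks) = ω^ n ·Σω^ ks +ω^ fromℕ (n + k)

fsExponents : List ℕ → ℕ → List ℕ
fsExponents []           M = []
fsExponents (zero ∷ ks)  M = ks
fsExponents (suc k ∷ ks) M = replicate M k ++ ks

ω^·Σω^-replicate : ∀ n M k ks → ω^ n ·Σω^ (replicate M k ++ ks) ≡ (ω^ n ·Σω^ ks) +ω^ fromℕ (n + k) · M
ω^·Σω^-replicate n zero    k ks = refl
ω^·Σω^-replicate n (suc M) k ks = cong (_+ω^ fromℕ (n + k)) (ω^·Σω^-replicate n M k ks)

fs-ω^0·Σω^ : ∀ ks M → fs (ω^ 0 ·Σω^ ks) M ≡ ω^ 0 ·Σω^ fsExponents ks M
fs-ω^0·Σω^ []           M = refl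
fs-ω^0·Σω^ (zero ∷ ks)  M = refl
fs-ω^0·Σω^ (suc k ∷ ks) M = sym (ω^·Σω^-replicate 0 M k ks)

large-ω^·Σω^⇒suffix : ∀ n k ks {M Z} → All (M <_) Z → Large (ω^ n ·Σω^ (k ∷ ks)) Z →
  HasLargeSuffix (ω^ n ·Σω^ fsExponents (k ∷ ks) M +ω^ fromℕ n) Z
large-ω^·Σω^⇒suffix n zero    ks below large = large-+ω^-lower⇒suffix n 0 (All.map m<n⇒0<n below) large
large-ω^·Σω^⇒suffix n (suc k) ks {Z = []} _ ()
large-ω^·Σω^⇒suffix n (suc k) ks {M} {x ∷ Z} (M<x ∷ below) large rewrite +-suc n k
  with P , W , refl , largeW ← large-+ω^-suc⇒suffix {Z = Z} M<x large
  = ++-hasLargeSuffix (x ∷ P)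
      (large-+ω^-lower⇒suffix n k (All.map m<n⇒0<n (++⁻ʳ P below))
        (subst (λ α → Large (α +ω^ fromℕ (n + k)) W) (sym (ω^·Σω^-replicate n M k ks)) largeW))

AllPairs-++⁻ : ∀ {A : Set} {R : A → A → Set} xs {ys} → AllPairs R (xs ++ ys) →
  AllPairs R xs × AllPairs R ys × All (λ x → All (R x) ys) xs
AllPairs-++⁻ []       pairs              = [] , pairs , []
AllPairs-++⁻ (x ∷ xs) (x~xs++ys ∷ pairs) with xsPairs , ysPairs , xs~ys ← AllPairs-++⁻ xs pairs
  = ++⁻ˡ xs x~xs++ys ∷ xsPairs , ysPairs , ++⁻ʳ xs x~xs++ys ∷ xs~ys

maxₛ-<ₛ : ∀ {b B Z} → (b ∷ B) <ₛ Z → All (maxₛ (b ∷ B) <_) Z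
maxₛ-<ₛ b∷B<Z =
  All.map (λ below → foldr-preservesᵇ ⊔-lub (m<n⇒0<n (All.head below)) below) (All-swap b∷B<Z)

BlockDecomposition : ℕ → Ord → List ℕ → Set
BlockDecomposition n α Z = Σ ℕ λ d → Σ (Fin (suc d) → List ℕ) λ Xs →
  ((i : Fin (suc d)) → Linked _<_ (Xs i) × Xs i ⊆ Z × Large (ω^ fromℕ n) (Xs i))
  × ((i j : Fin (suc d)) → i Fin.< j → Xs i <ₛ Xs j)
  × Large α (tabulate (λ (i : Fin d) → maxₛ (Xs (inject₁ i))))

singleBlock : ∀ {n Z} → Linked _<_ Z → Large (ω^ fromℕ n) Z → BlockDecomposition n 𝟎 Z
singleBlock {Z = Z} sorted large =
  0 , (λ _ → Z) , (λ _ → sorted , (λ x∈Z → x∈Z) , large) , (λ { Fin.zero Fin.zero () }) , refl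

consBlock : ∀ {n α B W Z} → Linked _<_ B → B ⊆ Z → Large (ω^ fromℕ n) B → W ⊆ Z → B <ₛ W →
  BlockDecomposition n (fs α (maxₛ B)) W → BlockDecomposition n α Z
consBlock {n} {B = B} {Z = Z} sortedB B⊆Z largeB W⊆Z B<W (d , Xs , blocks , ordered , maxima) =
  suc d , Ys , blocksʸ , orderedʸ , maxima
  where
  Ys : Fin (suc (suc d)) → List ℕ
  Ys Fin.zero    = B
  Ys (Fin.suc i) = Xs i

  blocksʸ : (i : Fin (suc (suc d))) → Linked _<_ (Ys i) × Ys i ⊆ Z × Large (ω^ fromℕ n) (Ys i)
  blocksʸ Fin.zero = sortedB , B⊆Z , largeB
  blocksʸ (Fin.suc i) with sorted , Xᵢ⊆W , large ← blocks i =
    sorted , (λ x∈Xᵢ → W⊆Z (Xᵢ⊆W x∈Xᵢ)) , large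

  orderedʸ : (i j : Fin (suc (suc d))) → i Fin.< j → Ys i <ₛ Ys j
  orderedʸ Fin.zero    Fin.zero    ()
  orderedʸ (Fin.suc i) Fin.zero    ()
  orderedʸ Fin.zero    (Fin.suc j) _         with _ , Xⱼ⊆W , _ ← blocks j = All.map (anti-mono Xⱼ⊆W) B<W
  orderedʸ (Fin.suc i) (Fin.suc j) (s≤s i<j) = ordered i j i<j

blockDecomposition : ∀ n β Z → Acc _<_ (length Z) → AllPairs _<_ Z →
  Large (ω^ n ·Σω^ β +ω^ fromℕ n) Z → BlockDecomposition n (ω^ 0 ·Σω^ β) Z
blockDecomposition n []       Z _         sorted large = singleBlock (AllPairs⇒Linked sorted) large
blockDecomposition n (k ∷ ks) Z (acc rec) sorted large
  with large-⊕⇒++ (ω^ n ·Σω^ (k ∷ ks)) (ω^ fromℕ n) Z large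
... | [] , _ , _ , () , _
... | b ∷ B , Z' , refl , largeB , largeZ'
  with sortedB , sortedZ' , B<Z' ← AllPairs-++⁻ (b ∷ B) sorted
  with P , W , refl , largeW ← large-ω^·Σω^⇒suffix n k ks (maxₛ-<ₛ B<Z') largeZ'
  with _ , sortedW , _ ← AllPairs-++⁻ P sortedZ'
  = consBlock (AllPairs⇒Linked sortedB) ∈-++⁺ˡ largeB (λ x∈W → ∈-++⁺ʳ (b ∷ B) (∈-++⁺ʳ P x∈W))
      (All.map (++⁻ʳ P) B<Z')
      (subst (λ α → BlockDecomposition n α W) (sym (fs-ω^0·Σω^ (k ∷ ks) M))
        (blockDecomposition n (fsExponents (k ∷ ks) M) W (rec W-shorter) sortedW largeW))
  where
  M = maxₛ (b ∷ B)
  W-shorter : length W < length (b ∷ B ++ P ++ W)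
  W-shorter = s≤s (≤-trans (length-++-≤ʳ W {P}) (length-++-≤ʳ (P ++ W) {B}))

mainTheorem8 : (n m : ℕ) (X : List ℕ) → Linked _<_ X →
    Large ((ω^ fromℕ (n + m)) +ω^ fromℕ n) X →
    Σ ℕ λ d → Σ (Fin (suc d) → List ℕ) λ Xs →
      ((i : Fin (suc d)) →
        Linked _<_ (Xs i) × (∀ {x} → x ∈ Xs i → x ∈ X) × Large (ω^ fromℕ n) (Xs i))
      × ((i j : Fin (suc d)) → i Fin.< j → Xs i <ₛ Xs j)
      × Large (ω^ fromℕ m) (tabulate (λ (i : Fin d) → maxₛ (Xs (inject₁ i))))
mainTheorem8 n m X sorted large =
  blockDecomposition n (m ∷ []) X (<-wellFounded (length X)) (Linked⇒AllPairs <-trans sorted) large
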